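{- Let $F$ be a QCL-formula and $\mathbf{Q}\in\{\mathbf{P},\mathbf{O}\}$. In the game tree $T(\mathbf{Q}:F)$ with the preference relation $\ll=\ll_{\mathbf{Q}:F}$ of the game $\mathbf{NG}$ (defined in the context), the maximum length $n$ of a sequence $O_1,\dots,O_n$ of pairwise distinct outcomes in $\mathcal{O}(\mathbf{Q}:F)$ with $O_i\ll O_{i+1}$ for all $1\le i\le n-1$ equals $\mathrm{opt}^G(F)$.
   Context: QCL-formulas are built from propositional variables (from an infinite set $\mathcal{U}$) using $\neg$, $\wedge$, $\vee$ and the binary connective $\vec{\times}$. GCL-optionality: $\mathrm{opt}^G(a)=1$; $\mathrm{opt}^G(\neg F)=\mathrm{opt}^G(F)$; $\mathrm{opt}^G(F\circ G)=\max(\mathrm{opt}^G(F),\mathrm{opt}^G(G))$ for $\circ\in\{\wedge,\vee\}$; $\mathrm{opt}^G(F\vec{\times}G)=\mathrm{opt}^G(F)+\mathrm{opt}^G(G)$. Game trees: nodes are game states $\mathbf{Q}:H$ with $\mathbf{Q}\in\{\mathbf{P},\mathbf{O}\}$; write $\bar{\mathbf{P}}=\mathbf{O}$, $\bar{\mathbf{O}}=\mathbf{P}$. $T(\mathbf{Q}:a)$ is a single leaf $\mathbf{Q}:a$. $T(\mathbf{Q}:\neg G)$ has root $\mathbf{Q}:\neg G$ with single immediate subtree $T(\bar{\mathbf{Q}}:G)$. For $\circ\in\{\wedge,\vee,\vec{\times}\}$, $T(\mathbf{Q}:G_1\circ G_2)$ has root $\mathbf{Q}:G_1\circ G_2$ with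 immediate subtrees $T(\mathbf{Q}:G_1)$, $T(\mathbf{Q}:G_2)$. Leaves of $T(\mathbf{Q}:F)$ form the outcome set $\mathcal{O}(\mathbf{Q}:F)$. Preference relations in $\mathbf{NG}$: $\ll_{\mathbf{P}:a}=\emptyset$; $\ll_{\mathbf{P}:\neg G}=\ll_{\mathbf{O}:G}$; $\ll_{\mathbf{P}:G_1\wedge G_2}=\ll_{\mathbf{P}:G_1\vee G_2}=\ll_{\mathbf{P}:G_1}\cup\ll_{\mathbf{P}:G_2}$; $O_1\ll_{\mathbf{P}:G_1\vec{\times}G_2}O_2$ iff ($O_1\in\mathcal{O}(\mathbf{P}:G_2)$ and $O_2\in\mathcal{O}(\mathbf{P}:G_1)$) or $O_1\ll_{\mathbf{P}:G_j}O_2$ for some $j\in\{1,2\}$; and for every formula $H$, $\ll_{\mathbf{O}:H}$ is the inverse relation of $\ll_{\mathbf{P}:H}$ (i.e. $O_1\ll_{\mathbf{O}:H}O_2$ iff $O_2\ll_{\mathbf{P}:H}O_1$). -}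

module Defs where

open import Data.Nat using (ℕ; suc; _+_; _⊔_)
open import Data.Empty using (⊥)
open import Data.Unit using (⊤)
open import Data.List using (List)
open import Data.List.Relation.Unary.Unique.Propositional using (Unique)
open import Data.List.Relation.Unary.Linked using (Linked)
open import Data.Product using (_×_)

-- Propositional variables: the infinite set 𝒰 is represented by ℕ.
Var : Set
Var = ℕ

data Formula : Set where
  atom : Var → Formula
  ¬ᶠ_  : Formula → Formula
  _∧ᶠ_ : Formula → Formula → Formula
  _∨ᶠ_ : Formula → Formula → Formula
  _×⃗_  : Formula → Formula → Formula

optG : Formula → ℕ
optG (atom a)  = 1
optG (¬ᶠ F)    = optG F
optG (F ∧ᶠ G)  = optG F ⊔ optG G
optG (F ∨ᶠ G)  = optG F ⊔ optG G
optG (F ×⃗ G)  = optG F + optG G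

data Player : Set where
  P O : Player

flip : Player → Player
flip P = O
flip O = P

record GameState : Set where
  constructor _∶_
  field
    player  : Player
    formula : Formula

-- Leaves of the game tree T(Q : F), as positions in the tree.
-- The shape of T(Q : F) does not depend on Q, so positions are indexed by F.
data Leaf : Formula → Set where
  leaf  : ∀ {a} → Leaf (atom a)
  neg   : ∀ {G} → Leaf G → Leaf (¬ᶠ G)
  ∧₁    : ∀ {G₁ G₂} → Leaf G₁ → Leaf (G₁ ∧ᶠ G₂)
  ∧₂    : ∀ {G₁ G₂} → Leaf G₂ → Leaf (G₁ ∧ᶠ G₂)
  ∨₁    : ∀ {G₁ G₂} → Leaf G₁ → Leaf (G₁ ∨ᶠ G₂)
  ∨₂    : ∀ {G₁ G₂} → Leaf G₂ → Leaf (G₁ ∨ᶠ G₂)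
  ×₁    : ∀ {G₁ G₂} → Leaf G₁ → Leaf (G₁ ×⃗ G₂)
  ×₂    : ∀ {G₁ G₂} → Leaf G₂ → Leaf (G₁ ×⃗ G₂)

label : (Q : Player) (F : Formula) → Leaf F → GameState
label Q (atom a)   leaf    = Q ∶ atom a
label Q (¬ᶠ G)     (neg l) = label (flip Q) G l
label Q (G₁ ∧ᶠ G₂) (∧₁ l)  = label Q G₁ l
label Q (G₁ ∧ᶠ G₂) (∧₂ l)  = label Q G₂ l
label Q (G₁ ∨ᶠ G₂) (∨₁ l)  = label Q G₁ l
label Q (G₁ ∨ᶠ G₂) (∨₂ l)  = label Q G₂ l
label Q (G₁ ×⃗ G₂) (×₁ l)  = label Q G₁ l
label Q (G₁ ×⃗ G₂) (×₂ l)  = label Q G₂ l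

-- Preference relations of NG.  prefP F O₁ O₂  means  O₁ ≪_{P:F} O₂, and
-- pref Q F O₁ O₂  means  O₁ ≪_{Q:F} O₂, where ≪_{O:H} is the inverse of ≪_{P:H}.
-- Outcomes of the subtree T(Q:Gᵢ) are embedded via the position constructors.
-- (The ¬ clause  ≪_{P:¬G} = ≪_{O:G} = inverse of ≪_{P:G}  is unfolded directly
--  so that the definition is structurally recursive.)
prefP : (F : Formula) → Leaf F → Leaf F → Set
prefP (atom a)   _       _       = ⊥
prefP (¬ᶠ G)     (neg x) (neg y) = prefP G y x
prefP (G₁ ∧ᶠ G₂) (∧₁ x) (∧₁ y) = prefP G₁ x y
prefP (G₁ ∧ᶠ G₂) (∧₂ x) (∧₂ y) = prefP G₂ x y
prefP (G₁ ∧ᶠ G₂) (∧₁ x) (∧₂ y) = ⊥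
prefP (G₁ ∧ᶠ G₂) (∧₂ x) (∧₁ y) = ⊥
prefP (G₁ ∨ᶠ G₂) (∨₁ x) (∨₁ y) = prefP G₁ x y
prefP (G₁ ∨ᶠ G₂) (∨₂ x) (∨₂ y) = prefP G₂ x y
prefP (G₁ ∨ᶠ G₂) (∨₁ x) (∨₂ y) = ⊥
prefP (G₁ ∨ᶠ G₂) (∨₂ x) (∨₁ y) = ⊥
prefP (G₁ ×⃗ G₂) (×₁ x) (×₁ y) = prefP G₁ x y
prefP (G₁ ×⃗ G₂) (×₂ x) (×₂ y) = prefP G₂ x y
prefP (G₁ ×⃗ G₂) (×₂ x) (×₁ y) = ⊤
prefP (G₁ ×⃗ G₂) (×₁ x) (×₂ y) = ⊥

pref : (Q : Player) (F : Formula) → Leaf F → Leaf F → Set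
pref P F x y = prefP F x y
pref O F x y = prefP F y x

IsChain : (Q : Player) (F : Formula) → List (Leaf F) → Set
IsChain Q F os = Unique os × Linked (pref Q F) os

{-# OPTIONS --safe #-}
module Submission where

-- Each outcome of T(Q : F) gets a rank below opt^G(F): ∧ and ∨ keep the
-- ranks of their branches, ¬ takes the rank for the other player, and at
-- G₁ ×⃗ G₂ the ranks of the preferred block are shifted above those of the
-- other block, which occupy [0, opt^G of that side).  Ranks strictly increase
-- along ≪, so a chain is duplicate-free and has length at most opt^G(F).
-- Conversely, following the same recursion, the longer of the two chains at
-- ∧ and ∨, and the concatenation of the two chains at ×⃗, attain the bound.

open import Defs
open import Level using (Level)
open import Data.Nat using (ℕ; suc; _+_; _⊔_; _≤_; _<_; z≤n; s≤s)
open import Data.Nat.Properties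
open import Data.Unit using (tt)
open import Data.Sum using (inj₁; inj₂)
open import Data.List using (List; []; _∷_; [_]; length; map; _++_)
open import Data.List.Properties using (length-map; length-++)
open import Data.List.Relation.Unary.Linked as Linked using (Linked; []; [-]; _∷_)
open import Data.List.Relation.Unary.Linked.Properties using (Linked⇒AllPairs; map⁺)
open import Data.List.Relation.Unary.Unique.Propositional using (Unique)
import Data.List.Relation.Unary.AllPairs as AllPairs
open import Data.Product using (Σ; Σ-syntax; _×_; _,_)
open import Function using (id; _on_)
open import Relation.Binary using (Rel; _⇒_)
import Relation.Binary.Construct.On as On
open import Relation.Binary.PropositionalEquality
  using (_≡_; refl; sym; cong; cong₂; trans; subst)

private
  variable
    a ℓ : Level
    A B C : Set a
    m n : ℕ

module _ {R : Rel A ℓ} (f : A → ℕ) (f-mono : R ⇒ (_<_ on f)) where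

  Linked⇒Unique : ∀ {xs} → Linked R xs → Unique xs
  Linked⇒Unique l =
    AllPairs.map (λ fx<fy x≡y → <-irrefl (cong f x≡y) fx<fy)
      (Linked⇒AllPairs (On.transitive f _<_ <-trans) (Linked.map f-mono l))

  module _ (f-bounded : ∀ x → f x < n) where

    length+head<bound : ∀ {x xs} → Linked R (x ∷ xs) → length xs + f x < n
    length+head<bound {x} [-] = f-bounded x
    length+head<bound {x} {y ∷ ys} (Rxy ∷ l) = begin-strict
      suc (length ys) + f x   ≡⟨ sym (+-suc (length ys) (f x)) ⟩
      length ys + suc (f x)   ≤⟨ +-monoʳ-≤ (length ys) (f-mono Rxy) ⟩
      length ys + f y         <⟨ length+head<bound l ⟩
      n                       ∎
      where open ≤-Reasoning

    Linked⇒length≤ : ∀ {xs} → Linked R xs → length xs ≤ n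
    Linked⇒length≤ {[]}     _ = z≤n
    Linked⇒length≤ {x ∷ xs} l = ≤-trans (s≤s (m≤m+n (length xs) (f x))) (length+head<bound l)

++⁺-map : {S : Rel C ℓ} {f : A → C} {g : B → C} →
  (∀ x y → S (f x) (g y)) →
  ∀ {xs ys} → Linked (S on f) xs → Linked (S on g) ys → Linked S (map f xs ++ map g ys)
++⁺-map cross []                     l = map⁺ l
++⁺-map cross {x ∷ []} {[]}    [-]   l = [-]
++⁺-map cross {x ∷ []} {y ∷ _} [-]   l = cross x y ∷ map⁺ l
++⁺-map cross (Rxy ∷ l₁)             l₂ = Rxy ∷ ++⁺-map cross l₁ l₂

LinkedOfLength : Rel A ℓ → ℕ → Set _
LinkedOfLength {A = A} R n = Σ[ xs ∈ List A ] Linked R xs × length xs ≡ n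

module _ {R : Rel A ℓ} where

  mapᴸ : {S : Rel B ℓ} (f : A → B) → R ⇒ (S on f) → LinkedOfLength R n → LinkedOfLength S n
  mapᴸ f f-mono (xs , l , refl) = map f xs , map⁺ (Linked.map f-mono l) , length-map f xs

  longer : LinkedOfLength R m → LinkedOfLength R n → LinkedOfLength R (m ⊔ n)
  longer {m} {n} c₁ c₂ with ⊔-sel m n
  ... | inj₁ m⊔n≡m = subst (LinkedOfLength R) (sym m⊔n≡m) c₁
  ... | inj₂ m⊔n≡n = subst (LinkedOfLength R) (sym m⊔n≡n) c₂

  appendᴸ : {R′ : Rel B ℓ} {S : Rel C ℓ} (f : A → C) (g : B → C) →
    R ⇒ (S on f) → R′ ⇒ (S on g) → (∀ x y → S (f x) (g y)) →
    LinkedOfLength R m → LinkedOfLength R′ n → LinkedOfLength S (m + n)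
  appendᴸ f g f-mono g-mono cross (xs , l₁ , refl) (ys , l₂ , refl) =
    map f xs ++ map g ys ,
    ++⁺-map cross (Linked.map f-mono l₁) (Linked.map g-mono l₂) ,
    trans (length-++ (map f xs)) (cong₂ _+_ (length-map f xs) (length-map g ys))

rank : (Q : Player) (F : Formula) → Leaf F → ℕ
rank Q (atom _)   leaf    = 0
rank Q (¬ᶠ G)     (neg l) = rank (flip Q) G l
rank Q (G₁ ∧ᶠ G₂) (∧₁ l)  = rank Q G₁ l
rank Q (G₁ ∧ᶠ G₂) (∧₂ l)  = rank Q G₂ l
rank Q (G₁ ∨ᶠ G₂) (∨₁ l)  = rank Q G₁ l
rank Q (G₁ ∨ᶠ G₂) (∨₂ l)  = rank Q G₂ l
rank P (G₁ ×⃗ G₂) (×₁ l)  = optG G₂ + rank P G₁ l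
rank P (G₁ ×⃗ G₂) (×₂ l)  = rank P G₂ l
rank O (G₁ ×⃗ G₂) (×₁ l)  = rank O G₁ l
rank O (G₁ ×⃗ G₂) (×₂ l)  = optG G₁ + rank O G₂ l

rank<optG : ∀ Q F l → rank Q F l < optG F
rank<optG Q (atom _)   leaf    = s≤s z≤n
rank<optG Q (¬ᶠ G)     (neg l) = rank<optG (flip Q) G l
rank<optG Q (G₁ ∧ᶠ G₂) (∧₁ l)  = <-≤-trans (rank<optG Q G₁ l) (m≤m⊔n _ _)
rank<optG Q (G₁ ∧ᶠ G₂) (∧₂ l)  = <-≤-trans (rank<optG Q G₂ l) (m≤n⊔m _ _)
rank<optG Q (G₁ ∨ᶠ G₂) (∨₁ l)  = <-≤-trans (rank<optG Q G₁ l) (m≤m⊔n _ _)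
rank<optG Q (G₁ ∨ᶠ G₂) (∨₂ l)  = <-≤-trans (rank<optG Q G₂ l) (m≤n⊔m _ _)
rank<optG P (G₁ ×⃗ G₂) (×₁ l)  =
  <-≤-trans (+-monoʳ-< (optG G₂) (rank<optG P G₁ l)) (≤-reflexive (+-comm (optG G₂) (optG G₁)))
rank<optG P (G₁ ×⃗ G₂) (×₂ l)  = <-≤-trans (rank<optG P G₂ l) (m≤n+m _ _)
rank<optG O (G₁ ×⃗ G₂) (×₁ l)  = <-≤-trans (rank<optG O G₁ l) (m≤m+n _ _)
rank<optG O (G₁ ×⃗ G₂) (×₂ l)  = +-monoʳ-< (optG G₁) (rank<optG O G₂ l)

pref⇒rank< : ∀ Q F → pref Q F ⇒ (_<_ on rank Q F)
pref⇒rank< P (atom _) ()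
pref⇒rank< O (atom _) ()
pref⇒rank< P (¬ᶠ G) {neg _} {neg _} r = pref⇒rank< O G r
pref⇒rank< O (¬ᶠ G) {neg _} {neg _} r = pref⇒rank< P G r
pref⇒rank< P (G₁ ∧ᶠ G₂) {∧₁ _} {∧₁ _} r = pref⇒rank< P G₁ r
pref⇒rank< P (G₁ ∧ᶠ G₂) {∧₂ _} {∧₂ _} r = pref⇒rank< P G₂ r
pref⇒rank< O (G₁ ∧ᶠ G₂) {∧₁ _} {∧₁ _} r = pref⇒rank< O G₁ r
pref⇒rank< O (G₁ ∧ᶠ G₂) {∧₂ _} {∧₂ _} r = pref⇒rank< O G₂ r
pref⇒rank< P (G₁ ∨ᶠ G₂) {∨₁ _} {∨₁ _} r = pref⇒rank< P G₁ r
pref⇒rank< P (G₁ ∨ᶠ G₂) {∨₂ _} {∨₂ _} r = pref⇒rank< P G₂ r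
pref⇒rank< O (G₁ ∨ᶠ G₂) {∨₁ _} {∨₁ _} r = pref⇒rank< O G₁ r
pref⇒rank< O (G₁ ∨ᶠ G₂) {∨₂ _} {∨₂ _} r = pref⇒rank< O G₂ r
pref⇒rank< P (G₁ ×⃗ G₂) {×₁ _} {×₁ _} r = +-monoʳ-< (optG G₂) (pref⇒rank< P G₁ r)
pref⇒rank< P (G₁ ×⃗ G₂) {×₂ _} {×₂ _} r = pref⇒rank< P G₂ r
pref⇒rank< P (G₁ ×⃗ G₂) {×₂ x} {×₁ _} _ = <-≤-trans (rank<optG P G₂ x) (m≤m+n _ _)
pref⇒rank< O (G₁ ×⃗ G₂) {×₁ _} {×₁ _} r = pref⇒rank< O G₁ r
pref⇒rank< O (G₁ ×⃗ G₂) {×₂ _} {×₂ _} r = +-monoʳ-< (optG G₁) (pref⇒rank< O G₂ r)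
pref⇒rank< O (G₁ ×⃗ G₂) {×₁ x} {×₂ _} _ = <-≤-trans (rank<optG O G₁ x) (m≤m+n _ _)

longestChain : ∀ Q F → LinkedOfLength (pref Q F) (optG F)
longestChain Q (atom _)   = [ leaf ] , [-] , refl
longestChain P (¬ᶠ G)     = mapᴸ neg id (longestChain O G)
longestChain O (¬ᶠ G)     = mapᴸ neg id (longestChain P G)
longestChain P (G₁ ∧ᶠ G₂) = longer (mapᴸ ∧₁ id (longestChain P G₁)) (mapᴸ ∧₂ id (longestChain P G₂))
longestChain O (G₁ ∧ᶠ G₂) = longer (mapᴸ ∧₁ id (longestChain O G₁)) (mapᴸ ∧₂ id (longestChain O G₂))
longestChain P (G₁ ∨ᶠ G₂) = longer (mapᴸ ∨₁ id (longestChain P G₁)) (mapᴸ ∨₂ id (longestChain P G₂))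
longestChain O (G₁ ∨ᶠ G₂) = longer (mapᴸ ∨₁ id (longestChain O G₁)) (mapᴸ ∨₂ id (longestChain O G₂))
longestChain P (G₁ ×⃗ G₂) =
  subst (LinkedOfLength (pref P (G₁ ×⃗ G₂))) (+-comm (optG G₂) (optG G₁))
    (appendᴸ ×₂ ×₁ id id (λ _ _ → tt) (longestChain P G₂) (longestChain P G₁))
longestChain O (G₁ ×⃗ G₂) =
  appendᴸ ×₁ ×₂ id id (λ _ _ → tt) (longestChain O G₁) (longestChain O G₂)

lemma4 : (Q : Player) (F : Formula) →
    Σ (List (Leaf F)) (λ os → IsChain Q F os × length os ≡ optG F)
    × ((os : List (Leaf F)) → IsChain Q F os → length os ≤ optG F)
lemma4 Q F =
  let os , linked , length≡optG = longestChain Q F in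
  (os , (Linked⇒Unique (rank Q F) (pref⇒rank< Q F) linked , linked) , length≡optG) ,
  λ _ (_ , linked′) → Linked⇒length≤ (rank Q F) (pref⇒rank< Q F) (rank<optG Q F) linked′
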